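{- Let $\mathfrak{g}=\mathfrak{sp}_4(\mathbb{C})$ (type $C_2$). Let $\lambda=c_1\varpi_1+c_2\varpi_2$ with $c_1,c_2\in\mathbb{Z}$ and $2\mid c_1$, and let $\mu=n\varpi_1+m\varpi_2$ with $n,m\in\mathbb{N}$ and $2\mid n$. Consider the inequalities $L_1:\ c_1+c_2-n-m\ge 0$; $L_2:\ \tfrac{c_1-n}{2}+c_2-m\ge 0$; $L_3:\ c_2-n-m-1\ge 0$; $L_4:\ \tfrac{c_1-n}{2}-m-1\ge 0$; $L_5:\ \tfrac{ -c_1-n}{2}-m-2\ge 0$; $L_6:\ -c_2-n-m-3\ge 0$; $L_7:\ -c_1-c_2-n-m-4\ge 0$; $L_8:\ \tfrac{ -c_1-n}{2}-c_2-m-3\ge 0$, and write $\neg L_i$ for the failure of $L_i$. Then $\mathcal{A}(\lambda,\mu)$ equals: $\{1\}$ if $L_1,L_2,\neg L_4,\neg L_3$; $\{s_1\}$ if $L_3,L_2,\neg L_5,\neg L_1$; $\{s_2\}$ if $L_1,L_4,\neg L_2,\neg L_6$; $\{s_2s_1\}$ if $L_3,L_5,\neg L_2,\neg L_7$; $\{s_1s_2\}$ if $L_6,L_4,\neg L_8,\neg L_1$; $\{s_1s_2s_1\}$ if $L_7,L_5,\neg L_8,\neg L_3$; $\{s_2s_1s_2\}$ if $L_6,L_8,\neg L_4,\neg L_7$; $\{(s_2s_1)^2\}$ if $L_7,L_8,\neg L_5,\neg L_6$; $\{1,s_1\}$ if $L_1,L_3,\neg L_4,\neg L_5$; $\{1,s_2\}$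 if $L_2,L_4,\neg L_3,\neg L_6$; $\{s_1,s_2s_1\}$ if $L_2,L_5,\neg L_1,\neg L_7$; $\{s_2,s_1s_2\}$ if $L_1,L_6,\neg L_2,\neg L_8$; $\{s_2s_1,s_1s_2s_1\}$ if $L_3,L_7,\neg L_2,\neg L_8$; $\{s_1s_2,s_2s_1s_2\}$ if $L_4,L_8,\neg L_1,\neg L_7$; $\{s_1s_2s_1,(s_2s_1)^2\}$ if $L_5,L_8,\neg L_6,\neg L_3$; $\{s_2s_1s_2,(s_2s_1)^2\}$ if $L_6,L_7,\neg L_5,\neg L_4$; $\{1,s_1,s_2s_1\}$ if $L_1,L_5,\neg L_4,\neg L_7$; $\{1,s_1,s_2\}$ if $L_3,L_4,\neg L_5,\neg L_6$; $\{1,s_2,s_1s_2\}$ if $L_2,L_6,\neg L_3,\neg L_8$; $\{s_2,s_1s_2,s_2s_1s_2\}$ if $L_1,L_8,\neg L_2,\neg L_7$; $\{s_1s_2,s_2s_1s_2,(s_2s_1)^2\}$ if $L_7,L_4,\neg L_5,\neg L_1$; $\{s_2s_1s_2,(s_2s_1)^2,s_1s_2s_1\}$ if $L_6,L_5,\neg L_4,\neg L_3$; $\{(s_2s_1)^2,s_1s_2s_1,s_2s_1\}$ if $L_3,L_8,\neg L_2,\neg L_6$; $\{s_1,s_2s_1,s_1s_2s_1\}$ if $L_7,L_2,\neg L_8,\neg L_1$; and $\emptyset$ otherwise.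
   Context: $\mathfrak{sp}_4(\mathbb{C})$ has simple roots $\alpha_1$ (short), $\alpha_2$ (long), positive roots $\Phi^+=\{\alpha_1,\alpha_2,\alpha_1+\alpha_2,2\alpha_1+\alpha_2\}$, fundamental weights $\varpi_1=\alpha_1+\tfrac12\alpha_2$, $\varpi_2=\alpha_1+\alpha_2$, and $\rho=\varpi_1+\varpi_2=2\alpha_1+\tfrac32\alpha_2$. The Weyl group $W$ (dihedral of order 8) is generated by the simple reflections $s_1,s_2$, acting linearly with $s_i(\alpha_i)=-\alpha_i$, $s_1(\alpha_2)=\alpha_2+2\alpha_1$, $s_2(\alpha_1)=\alpha_1+\alpha_2$, and $s_i(\varpi_j)=\varpi_j-\delta_{ij}\alpha_j$. $\mathbb{N}=\{0,1,2,\dots\}$. Kostant's partition function $\wp(\xi)$ is the number of ways to write $\xi$ as a nonnegative integral linear combination of positive roots. The Weyl alternation set is $\mathcal{A}(\lambda,\mu)=\{\sigma\in W:\ \wp(\sigma(\lambda+\rho)-(\mu+\rho))>0\}$. -}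

module Defs where

open import Data.Nat using (ℕ; zero; suc)
import Data.Nat as ℕ
open import Data.Integer using (ℤ; +_; -_; _+_; _-_; _*_; _≤_; ∣_∣; _/ℕ_; 0ℤ; 1ℤ)
import Data.Integer as ℤ
open import Data.Product using (_×_; _,_; proj₁; proj₂)
open import Data.Product.Properties using (≡-dec)
open import Data.List using (List; []; _∷_; length; filter; concatMap; map; upTo)
open import Data.List.Membership.Propositional using (_∈_)
open import Function.Bundles using (_⇔_)
open import Relation.Nullary using (¬_)
open import Relation.Nullary.Decidable using (Dec)
open import Relation.Binary.PropositionalEquality using (_≡_)

-- Weights of sp₄(ℂ), written in the basis of fundamental weights:
-- (a , b) stands for a ϖ₁ + b ϖ₂.  All weights occurring here
-- (λ, μ, ρ, roots) are integral, so ℤ × ℤ suffices.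

Weight : Set
Weight = ℤ × ℤ

infixl 6 _⊕_ _⊖_
_⊕_ : Weight → Weight → Weight
(a , b) ⊕ (c , d) = (a + c , b + d)

_⊖_ : Weight → Weight → Weight
(a , b) ⊖ (c , d) = (a - c , b - d)

_·_ : ℕ → Weight → Weight
k · (a , b) = (+ k * a , + k * b)

ϖ₁ ϖ₂ : Weight
ϖ₁ = (1ℤ , 0ℤ)
ϖ₂ = (0ℤ , 1ℤ)

-- simple roots: ϖ₁ = α₁ + ½α₂, ϖ₂ = α₁ + α₂  ⇒  α₁ = 2ϖ₁ - ϖ₂, α₂ = 2ϖ₂ - 2ϖ₁
α₁ α₂ : Weight
α₁ = (+ 2 , - 1ℤ)
α₂ = (- (+ 2) , + 2)

ρ : Weight
ρ = ϖ₁ ⊕ ϖ₂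

β₁ β₂ β₃ β₄ : Weight
β₁ = α₁
β₂ = α₂
β₃ = α₁ ⊕ α₂
β₄ = (α₁ ⊕ α₁) ⊕ α₂

combo : ℕ × ℕ × ℕ × ℕ → Weight
combo (k₁ , k₂ , k₃ , k₄) = (((k₁ · β₁) ⊕ (k₂ · β₂)) ⊕ (k₃ · β₃)) ⊕ (k₄ · β₄)

box : ℕ → List (ℕ × ℕ × ℕ × ℕ)
box B = concatMap (λ k₁ → concatMap (λ k₂ → concatMap (λ k₃ → map (λ k₄ →
          (k₁ , k₂ , k₃ , k₄)) (upTo (suc B))) (upTo (suc B))) (upTo (suc B))) (upTo (suc B))

_≟W_ : (x y : Weight) → Dec (x ≡ y)
_≟W_ = ≡-dec ℤ._≟_ ℤ._≟_

-- Bound on the coefficients: for ξ = a ϖ₁ + b ϖ₂ the height of ξ (in root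
-- coordinates) is (3a + 4b)/2, every positive root has height ≥ 1, so in any
-- representation ξ = Σ kᵢ βᵢ each kᵢ ≤ ht ξ ≤ ∣ 3a + 4b ∣.  Hence counting
-- over this box counts ALL representations.
bound : Weight → ℕ
bound (a , b) = ∣ + 3 * a + + 4 * b ∣

℘ : Weight → ℕ
℘ ξ = length (filter (λ k → combo k ≟W ξ) (box (bound ξ)))

_⋆_ : ℤ → Weight → Weight
k ⋆ (x , y) = (k * x , k * y)

s₁-act s₂-act : Weight → Weight
s₁-act (a , b) = (a ⋆ (ϖ₁ ⊖ α₁)) ⊕ (b ⋆ ϖ₂)
s₂-act (a , b) = (a ⋆ ϖ₁) ⊕ (b ⋆ (ϖ₂ ⊖ α₂))

data W : Set where
  e s₁ s₂ s₂s₁ s₁s₂ s₁s₂s₁ s₂s₁s₂ [s₂s₁]² : W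

act : W → Weight → Weight
act e        v = v
act s₁       v = s₁-act v
act s₂       v = s₂-act v
act s₂s₁     v = s₂-act (s₁-act v)
act s₁s₂     v = s₁-act (s₂-act v)
act s₁s₂s₁   v = s₁-act (s₂-act (s₁-act v))
act s₂s₁s₂   v = s₂-act (s₁-act (s₂-act v))
act [s₂s₁]²  v = s₂-act (s₁-act (s₂-act (s₁-act v)))

𝒜 : Weight → Weight → W → Set
𝒜 lam μ σ = 0 ℕ.< ℘ (act σ (lam ⊕ ρ) ⊖ (μ ⊕ ρ))

_≐_ : (W → Set) → List W → Set
A ≐ S = ∀ σ → (A σ ⇔ (σ ∈ S))

-- The inequalities L₁,…,L₈ (for λ = c₁ϖ₁ + c₂ϖ₂, μ = nϖ₁ + mϖ₂).
-- Division by 2 is integer (floor) division; it is exact since 2 ∣ c₁, 2 ∣ n.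

data Ineq : Set where
  L₁ L₂ L₃ L₄ L₅ L₆ L₇ L₈ : Ineq

lhs : Ineq → (c₁ c₂ : ℤ) (n m : ℕ) → ℤ
lhs L₁ c₁ c₂ n m = c₁ + c₂ - + n - + m
lhs L₂ c₁ c₂ n m = (c₁ - + n) /ℕ 2 + c₂ - + m
lhs L₃ c₁ c₂ n m = c₂ - + n - + m - + 1
lhs L₄ c₁ c₂ n m = (c₁ - + n) /ℕ 2 - + m - + 1
lhs L₅ c₁ c₂ n m = (- c₁ - + n) /ℕ 2 - + m - + 2
lhs L₆ c₁ c₂ n m = - c₂ - + n - + m - + 3
lhs L₇ c₁ c₂ n m = - c₁ - c₂ - + n - + m - + 4
lhs L₈ c₁ c₂ n m = (- c₁ - + n) /ℕ 2 - c₂ - + m - + 3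

Holds : Ineq → (c₁ c₂ : ℤ) (n m : ℕ) → Set
Holds L c₁ c₂ n m = 0ℤ ≤ lhs L c₁ c₂ n m

record Case : Set where
  constructor case
  field
    pos₁ pos₂ neg₁ neg₂ : Ineq
    set : List W

CaseHolds : Case → (c₁ c₂ : ℤ) (n m : ℕ) → Set
CaseHolds (case p q r s _) c₁ c₂ n m =
  Holds p c₁ c₂ n m × Holds q c₁ c₂ n m × ¬ Holds r c₁ c₂ n m × ¬ Holds s c₁ c₂ n m

cases : List Case
cases =
    case L₁ L₂ L₄ L₃ (e ∷ [])
  ∷ case L₃ L₂ L₅ L₁ (s₁ ∷ [])
  ∷ case L₁ L₄ L₂ L₆ (s₂ ∷ [])
  ∷ case L₃ L₅ L₂ L₇ (s₂s₁ ∷ [])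
  ∷ case L₆ L₄ L₈ L₁ (s₁s₂ ∷ [])
  ∷ case L₇ L₅ L₈ L₃ (s₁s₂s₁ ∷ [])
  ∷ case L₆ L₈ L₄ L₇ (s₂s₁s₂ ∷ [])
  ∷ case L₇ L₈ L₅ L₆ ([s₂s₁]² ∷ [])
  ∷ case L₁ L₃ L₄ L₅ (e ∷ s₁ ∷ [])
  ∷ case L₂ L₄ L₃ L₆ (e ∷ s₂ ∷ [])
  ∷ case L₂ L₅ L₁ L₇ (s₁ ∷ s₂s₁ ∷ [])
  ∷ case L₁ L₆ L₂ L₈ (s₂ ∷ s₁s₂ ∷ [])
  ∷ case L₃ L₇ L₂ L₈ (s₂s₁ ∷ s₁s₂s₁ ∷ [])
  ∷ case L₄ L₈ L₁ L₇ (s₁s₂ ∷ s₂s₁s₂ ∷ [])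
  ∷ case L₅ L₈ L₆ L₃ (s₁s₂s₁ ∷ [s₂s₁]² ∷ [])
  ∷ case L₆ L₇ L₅ L₄ (s₂s₁s₂ ∷ [s₂s₁]² ∷ [])
  ∷ case L₁ L₅ L₄ L₇ (e ∷ s₁ ∷ s₂s₁ ∷ [])
  ∷ case L₃ L₄ L₅ L₆ (e ∷ s₁ ∷ s₂ ∷ [])
  ∷ case L₂ L₆ L₃ L₈ (e ∷ s₂ ∷ s₁s₂ ∷ [])
  ∷ case L₁ L₈ L₂ L₇ (s₂ ∷ s₁s₂ ∷ s₂s₁s₂ ∷ [])
  ∷ case L₇ L₄ L₅ L₁ (s₁s₂ ∷ s₂s₁s₂ ∷ [s₂s₁]² ∷ [])
  ∷ case L₆ L₅ L₄ L₃ (s₂s₁s₂ ∷ [s₂s₁]² ∷ s₁s₂s₁ ∷ [])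
  ∷ case L₃ L₈ L₂ L₆ ([s₂s₁]² ∷ s₁s₂s₁ ∷ s₂s₁ ∷ [])
  ∷ case L₇ L₂ L₈ L₁ (s₁ ∷ s₂s₁ ∷ s₁s₂s₁ ∷ [])
  ∷ []

-- Write ξ σ = σ(λ+ρ) − (μ+ρ) in the basis α₁, α₂ of simple roots.  As the simple roots are
-- positive roots, ℘ (ξ σ) > 0 exactly when both coefficients are nonnegative, and these two
-- coefficients are the left sides of two of the inequalities L₁ … L₈.  Arranged around the
-- octagon L₂ L₁ L₄ L₆ L₈ L₇ L₅ L₃, each σ is an edge and neighbouring edges differ by a simple
-- reflection, so the left sides ℓ satisfy ℓ (prev L) + ℓ (next L) + ⟨μ+ρ , β∨⟩ = κ ℓ L with
-- κ ∈ {1, 2} a negated Cartan integer.  Since μ+ρ is strictly dominant, ℓ is strictly concave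
-- around the octagon, so the inequalities that hold form an arc of at most four consecutive
-- ones; for such truth patterns the table is checked over all 2⁸ truth assignments.

module Submission where

open import Defs
open import Data.Nat using (ℕ)
open import Data.Integer using (ℤ; +_)
open import Data.Integer.Divisibility using (_∣_)
open import Data.Product using (_×_; _,_)
open import Data.List using ([])
open import Data.List.Membership.Propositional using (_∈_)
open import Relation.Nullary using (¬_)

open import Data.Bool using (Bool; true; false; T; if_then_else_)
import Data.Fin as Fin
open import Data.Fin.Subset using (Subset)
open import Data.Fin.Subset.Properties using (anySubset?)
open import Data.Integer
  using (-[1+_]; 0ℤ; 1ℤ; -1ℤ; -_; _-_; _+_; _*_; _≤_; _<_; _≤?_; _/ℕ_; ∣_∣; +≤+; +<+)
import Data.Integer.Properties as ℤ
open import Data.Integer.Divisibility.Signed using (divides; ∣ᵤ⇒∣)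
open import Data.Integer.Tactic.RingSolver using (solve-∀)
open import Data.List using (List; _∷_; filter; length; concatMap; map; upTo; lookup)
import Data.List.Membership.DecPropositional as DecMembership
open import Data.List.Membership.Propositional using (lose)
open import Data.List.Membership.Propositional.Properties
  using (∈-concatMap⁺; ∈-map⁺; ∈-upTo⁺; ∈-filter⁺; ∈-filter⁻; ∈-length)
open import Data.List.Relation.Unary.All as All using ()
open import Data.List.Relation.Unary.Any using (here; there; index)
open import Data.List.Relation.Unary.Any.Properties using (lookup-index)
import Data.Nat as ℕ
open import Data.Nat using (suc; z≤n; s≤s)
open import Data.Nat.DivMod using (m*n/n≡m; m*n%n≡0)
import Data.Nat.Divisibility as ℕ
import Data.Nat.Properties as ℕ
open import Data.Product using (proj₁; proj₂; ∃-syntax)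
import Data.Vec as Vec
open import Function.Bundles using (_⇔_; mk⇔; Equivalence)
import Function.Properties.Equivalence as ⇔
open import Relation.Binary.Definitions using (DecidableEquality)
open import Relation.Binary.PropositionalEquality
open import Relation.Nullary using (Dec; does; proof; ¬?; _×-dec_; _→-dec_)
open import Relation.Nullary.Decidable using (map′; from-no; decidable-stable; dec-true; T?)
open import Relation.Nullary.Reflects using (Reflects; invert)

infix 7 _α₁+_α₂

-- Opaque, so that unification recovers p and q from p α₁+ q α₂.
opaque
  _α₁+_α₂ : ℤ → ℤ → Weight
  p α₁+ q α₂ = p ⋆ α₁ ⊕ q ⋆ α₂

opaque
  unfolding _α₁+_α₂

  combo-in-simple-roots : ∀ k₁ k₂ k₃ k₄ →
    combo (k₁ , k₂ , k₃ , k₄) ≡ + (k₁ ℕ.+ (k₃ ℕ.+ (k₄ ℕ.+ k₄))) α₁+ + (k₂ ℕ.+ (k₃ ℕ.+ k₄)) α₂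
  combo-in-simple-roots k₁ k₂ k₃ k₄ =
    cong₂ _,_ (ϖ₁-part (+ k₁) (+ k₂) (+ k₃) (+ k₄)) (ϖ₂-part (+ k₁) (+ k₂) (+ k₃) (+ k₄))
    where
    ϖ₁-part : ∀ a b c d → a * + 2 + b * - + 2 + c * 0ℤ + d * + 2
                          ≡ (a + (c + (d + d))) * + 2 + (b + (c + d)) * - + 2
    ϖ₁-part = solve-∀
    ϖ₂-part : ∀ a b c d → a * -1ℤ + b * + 2 + c * 1ℤ + d * 0ℤ
                          ≡ (a + (c + (d + d))) * -1ℤ + (b + (c + d)) * + 2
    ϖ₂-part = solve-∀

  simple-roots-independent : ∀ {p q p′ q′} → p α₁+ q α₂ ≡ p′ α₁+ q′ α₂ → p ≡ p′ × q ≡ q′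
  simple-roots-independent {p} {q} {p′} {q′} eq = p≡p′ , ℤ.*-cancelˡ-≡ (+ 2) q q′ 2q≡2q′
    where
    open ≡-Reasoning
    α₁-part : ∀ p q → p * + 2 + q * - + 2 + (p * -1ℤ + q * + 2) ≡ p
    α₁-part = solve-∀
    α₂-part : ∀ p q → p * + 2 + q * - + 2 + (p * -1ℤ + q * + 2) + (p * -1ℤ + q * + 2) ≡ + 2 * q
    α₂-part = solve-∀
    p≡p′ : p ≡ p′
    p≡p′ = begin
      p     ≡⟨ α₁-part p q ⟨
      _     ≡⟨ cong (λ (a , b) → a + b) eq ⟩
      _     ≡⟨ α₁-part p′ q′ ⟩
      p′    ∎
    2q≡2q′ : + 2 * q ≡ + 2 * q′
    2q≡2q′ = begin
      + 2 * q     ≡⟨ α₂-part p q ⟨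
      _           ≡⟨ cong (λ (a , b) → a + b + b) eq ⟩
      _           ≡⟨ α₂-part p′ q′ ⟩
      + 2 * q′    ∎

  bound-simple-roots : ∀ P Q → bound (+ P α₁+ + Q α₂) ≡ P ℕ.+ P ℕ.+ (Q ℕ.+ Q)
  bound-simple-roots P Q = cong ∣_∣ (height (+ P) (+ Q))
    where
    height : ∀ p q → + 3 * (p * + 2 + q * - + 2) + + 4 * (p * -1ℤ + q * + 2) ≡ p + p + (q + q)
    height = solve-∀

∈-concatMap : ∀ {A B : Set} (f : A → List B) {x y xs} → x ∈ xs → y ∈ f x → y ∈ concatMap f xs
∈-concatMap f x∈ y∈ = ∈-concatMap⁺ f (lose x∈ y∈)

∈-box : ∀ {B k₁ k₂ k₃ k₄} → k₁ ℕ.≤ B → k₂ ℕ.≤ B → k₃ ℕ.≤ B → k₄ ℕ.≤ B → (k₁ , k₂ , k₃ , k₄) ∈ box B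
∈-box {B} {k₁} {k₂} {k₃} h₁ h₂ h₃ h₄ =
  ∈-concatMap layer₁ (∈-upTo⁺ (s≤s h₁)) (∈-concatMap (layer₂ k₁) (∈-upTo⁺ (s≤s h₂))
    (∈-concatMap (layer₃ k₁ k₂) (∈-upTo⁺ (s≤s h₃))
      (∈-map⁺ (λ d → (k₁ , k₂ , k₃ , d)) (∈-upTo⁺ (s≤s h₄)))))
  where
  U : List ℕ
  U = upTo (suc B)
  layer₃ : ℕ → ℕ → ℕ → List (ℕ × ℕ × ℕ × ℕ)
  layer₃ a b c = map (λ d → (a , b , c , d)) U
  layer₂ : ℕ → ℕ → List (ℕ × ℕ × ℕ × ℕ)
  layer₂ a b = concatMap (layer₃ a b) U
  layer₁ : ℕ → List (ℕ × ℕ × ℕ × ℕ)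
  layer₁ a = concatMap (layer₂ a) U

0<length⇒∈ : ∀ {A : Set} {xs : List A} → 0 ℕ.< length xs → ∃[ x ] x ∈ xs
0<length⇒∈ {xs = x ∷ _} _ = x , here refl

representations : Weight → List (ℕ × ℕ × ℕ × ℕ)
representations ξ = filter (λ k → combo k ≟W ξ) (box (bound ξ))

℘-positive⇒ : ∀ {p q} → 0 ℕ.< ℘ (p α₁+ q α₂) → 0ℤ ≤ p × 0ℤ ≤ q
℘-positive⇒ {p} {q} 0<℘
  with (k₁ , k₂ , k₃ , k₄) , k∈ ← 0<length⇒∈ {xs = representations (p α₁+ q α₂)} 0<℘
  with combo≡ ← proj₂ (∈-filter⁻ (λ k → combo k ≟W (p α₁+ q α₂)) {xs = box (bound (p α₁+ q α₂))} k∈)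
  with refl , refl ← simple-roots-independent (trans (sym (combo-in-simple-roots k₁ k₂ k₃ k₄)) combo≡)
  = +≤+ z≤n , +≤+ z≤n

℘-positive⇐ : ∀ P Q → 0 ℕ.< ℘ (+ P α₁+ + Q α₂)
℘-positive⇐ P Q = ∈-length (∈-filter⁺ (λ k → combo k ≟W ξ) (∈-box P≤ Q≤ z≤n z≤n) combo≡ξ)
  where
  ξ : Weight
  ξ = + P α₁+ + Q α₂
  P≤ : P ℕ.≤ bound ξ
  P≤ rewrite bound-simple-roots P Q = ℕ.≤-trans (ℕ.m≤m+n P P) (ℕ.m≤m+n (P ℕ.+ P) (Q ℕ.+ Q))
  Q≤ : Q ℕ.≤ bound ξ
  Q≤ rewrite bound-simple-roots P Q = ℕ.≤-trans (ℕ.m≤m+n Q Q) (ℕ.m≤n+m (Q ℕ.+ Q) (P ℕ.+ P))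
  combo≡ξ : combo (P , Q , 0 , 0) ≡ ξ
  combo≡ξ = trans (combo-in-simple-roots P Q 0 0)
    (cong₂ (λ p q → + p α₁+ + q α₂) (ℕ.+-identityʳ P) (ℕ.+-identityʳ Q))

℘-positive⇔ : ∀ p q → 0 ℕ.< ℘ (p α₁+ q α₂) ⇔ (0ℤ ≤ p × 0ℤ ≤ q)
℘-positive⇔ p q = mk⇔ ℘-positive⇒ λ where (+≤+ {n = P} _ , +≤+ {n = Q} _) → ℘-positive⇐ P Q

-- Strictly concave sequences around the octagon

-- Consecutive inequalities are the two root coordinates of one σ(λ+ρ) − (μ+ρ); see
-- α₁-coefficient and α₂-coefficient below.
next : Ineq → Ineq
next L₂ = L₁
next L₁ = L₄
next L₄ = L₆
next L₆ = L₈
next L₈ = L₇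
next L₇ = L₅
next L₅ = L₃
next L₃ = L₂

opposite : Ineq → Ineq
opposite L = next (next (next (next L)))

-- Whether the left side of L is a coefficient of the short simple root α₁ rather than of α₂.
short : Ineq → Bool
short L₁ = true
short L₃ = true
short L₆ = true
short L₇ = true
short _  = false

-- κ L = −⟨α , β∨⟩, where L measures the coefficient of the simple root α and β is the other one.
κ : Ineq → ℕ
κ L = if short L then 1 else 2

κ-alternates : ∀ L → κ L ℕ.* κ (next L) ≡ 2
κ-alternates L₁ = refl
κ-alternates L₂ = refl
κ-alternates L₃ = refl
κ-alternates L₄ = refl
κ-alternates L₅ = refl
κ-alternates L₆ = refl
κ-alternates L₇ = refl
κ-alternates L₈ = refl

κ-periodic : ∀ L → κ (next (next L)) ≡ κ L
κ-periodic L₁ = refl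
κ-periodic L₂ = refl
κ-periodic L₃ = refl
κ-periodic L₄ = refl
κ-periodic L₅ = refl
κ-periodic L₆ = refl
κ-periodic L₇ = refl
κ-periodic L₈ = refl

StrictlyConcave : (Ineq → ℤ) → Set
StrictlyConcave u = ∀ L → u L + u (next (next L)) < + κ (next L) * u (next L)

record Convex (H : Ineq → Set) : Set where
  field
    antipodal : ∀ L → H L → ¬ H (opposite L)
    fill₁     : ∀ L → H L → H (next (next L)) → H (next L)
    fill₂     : ∀ L → H L → H (next (next (next L))) → H (next L) × H (next (next L))

*-nonneg : ∀ k {x} → 0ℤ ≤ x → 0ℤ ≤ + k * x
*-nonneg k {+ n} _ = subst (0ℤ ≤_) (ℤ.pos-* k n) (+≤+ z≤n)

κ-product : ∀ L x → + κ L * (+ κ (next L) * x) ≡ x + x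
κ-product L x = begin
  + κ L * (+ κ (next L) * x)    ≡⟨ ℤ.*-assoc (+ κ L) _ x ⟨
  + κ L * + κ (next L) * x      ≡⟨ cong (_* x) (ℤ.pos-* (κ L) _) ⟨
  + (κ L ℕ.* κ (next L)) * x    ≡⟨ cong (λ k → + k * x) (κ-alternates L) ⟩
  + 2 * x                       ≡⟨ double x ⟩
  x + x                         ∎
  where
  open ≡-Reasoning
  double : ∀ x → + 2 * x ≡ x + x
  double = solve-∀

strictly-concave⇒convex : ∀ {u} → StrictlyConcave u → Convex (λ L → 0ℤ ≤ u L)
strictly-concave⇒convex {u} concave = record { antipodal = antipodal ; fill₁ = fill₁ ; fill₂ = fill₂ }
  where
  open ℤ.≤-Reasoning

  fill₁ : ∀ L → 0ℤ ≤ u L → 0ℤ ≤ u (next (next L)) → 0ℤ ≤ u (next L)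
  fill₁ L 0≤a 0≤c = ℤ.<⇒≤ (ℤ.*-cancelˡ-<-nonNeg (+ κ (next L)) (begin-strict
    + κ (next L) * 0ℤ             ≡⟨ ℤ.*-zeroʳ (+ κ (next L)) ⟩
    0ℤ                            ≤⟨ ℤ.+-mono-≤ 0≤a 0≤c ⟩
    u L + u (next (next L))       <⟨ concave L ⟩
    + κ (next L) * u (next L)     ∎))

  -- concave L plus k times concave (next L) leaves a + k d ≤ c.
  fill₂ : ∀ L → 0ℤ ≤ u L → 0ℤ ≤ u (next (next (next L))) → 0ℤ ≤ u (next L) × 0ℤ ≤ u (next (next L))
  fill₂ L 0≤a 0≤d = fill₁ L 0≤a 0≤c , 0≤c
    where
    a b c d k : ℤ
    a = u L
    b = u (next L)
    c = u (next (next L))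
    d = u (next (next (next L)))
    k = + κ (next L)
    rearrange : ∀ a c t → c + (a + t) ≡ a + c + t
    rearrange = solve-∀
    c+0≤c+c : c + 0ℤ ≤ c + c
    c+0≤c+c = begin
      c + 0ℤ                          ≤⟨ ℤ.+-monoʳ-≤ c (ℤ.+-mono-≤ 0≤a (*-nonneg (κ (next L)) 0≤d)) ⟩
      c + (a + k * d)                 ≡⟨ rearrange a c (k * d) ⟩
      a + c + k * d                   ≤⟨ ℤ.+-monoˡ-≤ (k * d) (ℤ.<⇒≤ (concave L)) ⟩
      k * b + k * d                   ≡⟨ ℤ.*-distribˡ-+ k b d ⟨
      k * (b + d)                     ≤⟨ ℤ.*-monoˡ-≤-nonNeg k (ℤ.<⇒≤ (concave (next L))) ⟩
      k * (+ κ (next (next L)) * c)   ≡⟨ κ-product (next L) c ⟩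
      c + c                           ∎
    0≤c : 0ℤ ≤ c
    0≤c = ℤ.≮⇒≥ λ c<0 → ℤ.<⇒≱ (ℤ.+-monoʳ-< c c<0) c+0≤c+c

  -- concave L, k times concave (next L) and concave (next (next L)) add up to a + f < 0.
  antipodal : ∀ L → 0ℤ ≤ u L → ¬ 0ℤ ≤ u (opposite L)
  antipodal L 0≤a 0≤f = ℤ.<⇒≱ a+f+X<X (ℤ.+-monoˡ-≤ X (ℤ.+-mono-≤ 0≤a 0≤f))
    where
    a b c d f k X : ℤ
    a = u L
    b = u (next L)
    c = u (next (next L))
    d = u (next (next (next L)))
    f = u (opposite L)
    k = + κ (next L)
    X = k * b + k * d + (c + c)
    regroup : ∀ a b c d f k → a + f + (k * b + k * d + (c + c)) ≡ a + c + k * (b + d) + (c + f)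
    regroup = solve-∀
    regroup′ : ∀ b c d k → k * b + (c + c) + k * d ≡ 0ℤ + (k * b + k * d + (c + c))
    regroup′ = solve-∀
    a+f+X<X : a + f + X < 0ℤ + X
    a+f+X<X = begin-strict
      a + f + X                       ≡⟨ regroup a b c d f k ⟩
      a + c + k * (b + d) + (c + f)   <⟨ ℤ.+-mono-< (ℤ.+-mono-<-≤ (concave L)
                                                      (ℤ.*-monoˡ-≤-nonNeg k (ℤ.<⇒≤ (concave (next L)))))
                                                    (concave (next (next L))) ⟩
      k * b + k * (+ κ (next (next L)) * c) + + κ (next (next (next L))) * d
                                      ≡⟨ cong₂ (λ s t → k * b + s + + t * d)
                                               (κ-product (next L) c) (κ-periodic (next L)) ⟩
      k * b + (c + c) + k * d         ≡⟨ regroup′ b c d k ⟩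
      0ℤ + X                          ∎

α₁-coefficient α₂-coefficient : W → Ineq
α₁-coefficient e       = L₁
α₁-coefficient s₁      = L₃
α₁-coefficient s₂      = L₁
α₁-coefficient s₂s₁    = L₃
α₁-coefficient s₁s₂    = L₆
α₁-coefficient s₁s₂s₁  = L₇
α₁-coefficient s₂s₁s₂  = L₆
α₁-coefficient [s₂s₁]² = L₇
α₂-coefficient e       = L₂
α₂-coefficient s₁      = L₂
α₂-coefficient s₂      = L₄
α₂-coefficient s₂s₁    = L₅
α₂-coefficient s₁s₂    = L₄
α₂-coefficient s₁s₂s₁  = L₅
α₂-coefficient s₂s₁s₂  = L₈
α₂-coefficient [s₂s₁]² = L₈

weyl-group : List W
weyl-group = e ∷ s₁ ∷ s₂ ∷ s₂s₁ ∷ s₁s₂ ∷ s₁s₂s₁ ∷ s₂s₁s₂ ∷ [s₂s₁]² ∷ []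

∈-weyl-group : ∀ σ → σ ∈ weyl-group
∈-weyl-group e       = here refl
∈-weyl-group s₁      = there (here refl)
∈-weyl-group s₂      = there (there (here refl))
∈-weyl-group s₂s₁    = there (there (there (here refl)))
∈-weyl-group s₁s₂    = there (there (there (there (here refl))))
∈-weyl-group s₁s₂s₁  = there (there (there (there (there (here refl)))))
∈-weyl-group s₂s₁s₂  = there (there (there (there (there (there (here refl))))))
∈-weyl-group [s₂s₁]² = there (there (there (there (there (there (there (here refl)))))))

_≟ᵂ_ : DecidableEquality W
σ ≟ᵂ τ = map′ injective (cong position) (position σ Fin.≟ position τ)
  where
  position : W → Fin.Fin 8
  position σ = index (∈-weyl-group σ)
  injective : position σ ≡ position τ → σ ≡ τ
  injective eq = trans (lookup-index (∈-weyl-group σ))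
                   (trans (cong (lookup weyl-group) eq) (sym (lookup-index (∈-weyl-group τ))))

open DecMembership _≟ᵂ_ using (_∈?_)

inequalities : List Ineq
inequalities = L₁ ∷ L₂ ∷ L₃ ∷ L₄ ∷ L₅ ∷ L₆ ∷ L₇ ∷ L₈ ∷ []

∈-inequalities : ∀ L → L ∈ inequalities
∈-inequalities L₁ = here refl
∈-inequalities L₂ = there (here refl)
∈-inequalities L₃ = there (there (here refl))
∈-inequalities L₄ = there (there (there (here refl)))
∈-inequalities L₅ = there (there (there (there (here refl))))
∈-inequalities L₆ = there (there (there (there (there (here refl)))))
∈-inequalities L₇ = there (there (there (there (there (there (here refl))))))
∈-inequalities L₈ = there (there (there (there (there (there (there (here refl)))))))

module _ {A : Set} {P : A → Set} where

  ∀-∈? : (xs : List A) → (∀ x → Dec (P x)) → Dec (∀ x → x ∈ xs → P x)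
  ∀-∈? xs P? = map′ (λ ps _ → All.lookup ps) (λ f → All.tabulate (λ {x} → f x)) (All.all? P? xs)

  ∀-enumerated? : (xs : List A) → (∀ x → x ∈ xs) → (∀ x → Dec (P x)) → Dec (∀ x → P x)
  ∀-enumerated? xs complete P? = map′ (λ f x → f x (complete x)) (λ f x _ → f x) (∀-∈? xs P?)

_⇔?_ : ∀ {A B : Set} → Dec A → Dec B → Dec (A ⇔ B)
a? ⇔? b? = map′ (λ (f , g) → mk⇔ f g) (λ A⇔B → Equivalence.to A⇔B , Equivalence.from A⇔B)
                ((a? →-dec b?) ×-dec (b? →-dec a?))

InCone : (Ineq → Set) → W → Set
InCone H σ = H (α₁-coefficient σ) × H (α₂-coefficient σ)

Satisfies : (Ineq → Set) → Case → Set
Satisfies H (case p q r s _) = H p × H q × ¬ H r × ¬ H s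

Table : (Ineq → Set) → Set
Table H = ((C : Case) → C ∈ cases → Satisfies H C → InCone H ≐ Case.set C)
        × (((C : Case) → C ∈ cases → ¬ Satisfies H C) → InCone H ≐ [])

module Decide {H : Ineq → Set} (H? : ∀ L → Dec (H L)) where

  ∀-inequalities? : ∀ {P : Ineq → Set} → (∀ L → Dec (P L)) → Dec (∀ L → P L)
  ∀-inequalities? = ∀-enumerated? inequalities ∈-inequalities

  convex? : Dec (Convex H)
  convex? = map′ (λ (a , f₁ , f₂) → record { antipodal = a ; fill₁ = f₁ ; fill₂ = f₂ })
                 (λ C → Convex.antipodal C , Convex.fill₁ C , Convex.fill₂ C)
                 (∀-inequalities? (λ L → H? L →-dec ¬? (H? (opposite L)))
                  ×-dec ∀-inequalities? (λ L → H? L →-dec (H? (next (next L)) →-dec H? (next L)))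
                  ×-dec ∀-inequalities? (λ L → H? L →-dec (H? (next (next (next L)))
                                                  →-dec (H? (next L) ×-dec H? (next (next L))))))

  satisfies? : ∀ C → Dec (Satisfies H C)
  satisfies? (case p q r s _) = H? p ×-dec H? q ×-dec ¬? (H? r) ×-dec ¬? (H? s)

  in-cone≐? : ∀ S → Dec (InCone H ≐ S)
  in-cone≐? S = ∀-enumerated? weyl-group ∈-weyl-group
                  (λ σ → (H? (α₁-coefficient σ) ×-dec H? (α₂-coefficient σ)) ⇔? (σ ∈? S))

  table? : Dec (Table H)
  table? = ∀-∈? cases (λ C → satisfies? C →-dec in-cone≐? (Case.set C))
           ×-dec (∀-∈? cases (λ C → ¬? (satisfies? C)) →-dec in-cone≐? [])

  convex⇒table? : Dec (Convex H → Table H)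
  convex⇒table? = convex? →-dec table?

open Decide using (convex⇒table?)

valuation : Subset 8 → Ineq → Bool
valuation v L = Vec.lookup v (index (∈-inequalities L))

valuation? : ∀ v L → Dec (T (valuation v L))
valuation? v L = T? (valuation v L)

convex⇒table-for-valuations : ∀ v → does (convex⇒table? (valuation? v)) ≡ true
convex⇒table-for-valuations v = dec-true (convex⇒table? (valuation? v))
  (decidable-stable (convex⇒table? (valuation? v)) λ ¬table → no-counterexample (v , ¬table))
  where
  no-counterexample : ¬ (∃[ v ] ¬ (Convex (λ L → T (valuation v L)) → Table (λ L → T (valuation v L))))
  no-counterexample = from-no (anySubset? (λ v → ¬? (convex⇒table? (valuation? v))))

-- The Boolean computed by convex⇒table? H? only depends on the eight values does (H? L), so it
-- is definitionally the one computed for the valuation listing them.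
alternation-table : ∀ {H} → (∀ L → Dec (H L)) → Convex H → Table H
alternation-table H? =
  invert (subst (Reflects _) (convex⇒table-for-valuations truths) (proof (convex⇒table? H?)))
  where
  truths : Subset 8
  truths = does (H? L₁) Vec.∷ does (H? L₂) Vec.∷ does (H? L₃) Vec.∷ does (H? L₄) Vec.∷
           does (H? L₅) Vec.∷ does (H? L₆) Vec.∷ does (H? L₇) Vec.∷ does (H? L₈) Vec.∷ Vec.[]

-- Root coordinates of σ(λ+ρ) − (μ+ρ)

i*2/ℕ2≡i : ∀ i → (i * + 2) /ℕ 2 ≡ i
i*2/ℕ2≡i (+ k) = trans (cong (_/ℕ 2) (sym (ℤ.pos-* k 2))) (cong +_ (m*n/n≡m k 2))
-- For a negative dividend, /ℕ branches on the remainder, which vanishes here.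
i*2/ℕ2≡i -[1+ k ] with suc (suc (k ℕ.* 2)) ℕ.% 2 | m*n%n≡0 (suc k) 2
... | _ | refl = cong (λ q → - (+ q)) (m*n/n≡m (suc k) 2)

halve : ∀ {y} h → h * + 2 ≡ y → y /ℕ 2 ≡ h
halve h refl = i*2/ℕ2≡i h

twice-difference : ∀ x J → (x - J) * + 2 ≡ x * + 2 - (J + J)
twice-difference = solve-∀

twice-difference′ : ∀ x J → (- x - J) * + 2 ≡ - (x * + 2) - (J + J)
twice-difference′ = solve-∀

⊕-⊖-cancel : ∀ v w → (v ⊕ w) ⊖ v ≡ w
⊕-⊖-cancel (a , b) (p , q) = cong₂ _,_ (cancel a p) (cancel b q)
  where
  cancel : ∀ a p → a + p - a ≡ p
  cancel = solve-∀

isolate₁ : ∀ {x y d z} → x + y + d ≡ z → z - y - d ≡ x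
isolate₁ {x} {y} {d} refl = cancel x y d
  where
  cancel : ∀ x y d → x + y + d - y - d ≡ x
  cancel = solve-∀

isolate₂ : ∀ {x y d z} → x + y + d ≡ z → z - x - d ≡ y
isolate₂ {x} {y} {d} refl = cancel x y d
  where
  cancel : ∀ x y d → x + y + d - x - d ≡ y
  cancel = solve-∀

positive-gap⇒< : ∀ {a d z} → 0ℤ < d → a + d ≡ z → a < z
positive-gap⇒< {a} 0<d refl = subst (_< a + _) (ℤ.+-identityʳ a) (ℤ.+-monoʳ-< a 0<d)

-- With ν = (N , M) ⊕ ρ: s (ν + ξ) = ν + s ξ − ⟨ν , α∨⟩ α for s the reflection in α, and
-- ⟨ν , α₁∨⟩ = 1 + N, ⟨ν , α₂∨⟩ = 1 + M.
opaque
  unfolding _α₁+_α₂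

  s₁-act-shifted : ∀ N M p q →
    s₁-act ((N , M) ⊕ ρ ⊕ p α₁+ q α₂) ≡ (N , M) ⊕ ρ ⊕ (+ 2 * q - p - (1ℤ + N)) α₁+ q α₂
  s₁-act-shifted N M p q = cong₂ _,_ (ϖ₁-part N M p q) (ϖ₂-part N M p q)
    where
    ϖ₁-part : ∀ N M p q →
      (N + 1ℤ + (p * + 2 + q * - + 2)) * (1ℤ - + 2) + (M + 1ℤ + (p * -1ℤ + q * + 2)) * 0ℤ
      ≡ N + 1ℤ + ((+ 2 * q - p - (1ℤ + N)) * + 2 + q * - + 2)
    ϖ₁-part = solve-∀
    ϖ₂-part : ∀ N M p q →
      (N + 1ℤ + (p * + 2 + q * - + 2)) * (0ℤ - -1ℤ) + (M + 1ℤ + (p * -1ℤ + q * + 2)) * 1ℤ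
      ≡ M + 1ℤ + ((+ 2 * q - p - (1ℤ + N)) * -1ℤ + q * + 2)
    ϖ₂-part = solve-∀

  s₂-act-shifted : ∀ N M p q →
    s₂-act ((N , M) ⊕ ρ ⊕ p α₁+ q α₂) ≡ (N , M) ⊕ ρ ⊕ p α₁+ (+ 1 * p - q - (1ℤ + M)) α₂
  s₂-act-shifted N M p q = cong₂ _,_ (ϖ₁-part N M p q) (ϖ₂-part N M p q)
    where
    ϖ₁-part : ∀ N M p q →
      (N + 1ℤ + (p * + 2 + q * - + 2)) * 1ℤ + (M + 1ℤ + (p * -1ℤ + q * + 2)) * (0ℤ - - + 2)
      ≡ N + 1ℤ + (p * + 2 + (+ 1 * p - q - (1ℤ + M)) * - + 2)
    ϖ₁-part = solve-∀
    ϖ₂-part : ∀ N M p q →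
      (N + 1ℤ + (p * + 2 + q * - + 2)) * 0ℤ + (M + 1ℤ + (p * -1ℤ + q * + 2)) * (1ℤ - + 2)
      ≡ M + 1ℤ + (p * -1ℤ + (+ 1 * p - q - (1ℤ + M)) * + 2)
    ϖ₂-part = solve-∀

recurrence-around-L₁ : ∀ x c J M →
  (x - J + c - M) + (x - J - M - + 1) + (1ℤ + M) ≡ + 1 * (x * + 2 + c - (J + J) - M)
recurrence-around-L₁ = solve-∀

recurrence-around-L₄ : ∀ x c J M →
  (x * + 2 + c - (J + J) - M) + (- c - (J + J) - M - + 3) + (1ℤ + (J + J)) ≡ + 2 * (x - J - M - + 1)
recurrence-around-L₄ = solve-∀

recurrence-around-L₆ : ∀ x c J M →
  (x - J - M - + 1) + (- x - J - c - M - + 3) + (1ℤ + M) ≡ + 1 * (- c - (J + J) - M - + 3)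
recurrence-around-L₆ = solve-∀

recurrence-around-L₈ : ∀ x c J M →
  (- c - (J + J) - M - + 3) + (- (x * + 2) - c - (J + J) - M - + 4) + (1ℤ + (J + J))
  ≡ + 2 * (- x - J - c - M - + 3)
recurrence-around-L₈ = solve-∀

recurrence-around-L₇ : ∀ x c J M →
  (- x - J - c - M - + 3) + (- x - J - M - + 2) + (1ℤ + M)
  ≡ + 1 * (- (x * + 2) - c - (J + J) - M - + 4)
recurrence-around-L₇ = solve-∀

recurrence-around-L₅ : ∀ x c J M →
  (- (x * + 2) - c - (J + J) - M - + 4) + (c - (J + J) - M - + 1) + (1ℤ + (J + J))
  ≡ + 2 * (- x - J - M - + 2)
recurrence-around-L₅ = solve-∀

recurrence-around-L₃ : ∀ x c J M →
  (- x - J - M - + 2) + (x - J + c - M) + (1ℤ + M) ≡ + 1 * (c - (J + J) - M - + 1)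
recurrence-around-L₃ = solve-∀

recurrence-around-L₂ : ∀ x c J M →
  (c - (J + J) - M - + 1) + (x * + 2 + c - (J + J) - M) + (1ℤ + (J + J)) ≡ + 2 * (x - J + c - M)
recurrence-around-L₂ = solve-∀

module Orbit (x c : ℤ) (j m : ℕ) where

  lam μ ν : Weight
  lam = (x * + 2 , c)
  μ   = (+ (j ℕ.+ j) , + m)
  ν   = μ ⊕ ρ

  ℓ : Ineq → ℤ
  ℓ L₁ = x * + 2 + c - + (j ℕ.+ j) - + m
  ℓ L₂ = x - + j + c - + m
  ℓ L₃ = c - + (j ℕ.+ j) - + m - + 1
  ℓ L₄ = x - + j - + m - + 1
  ℓ L₅ = - x - + j - + m - + 2
  ℓ L₆ = - c - + (j ℕ.+ j) - + m - + 3
  ℓ L₇ = - (x * + 2) - c - + (j ℕ.+ j) - + m - + 4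
  ℓ L₈ = - x - + j - c - + m - + 3

  lhs≡ℓ : ∀ L → lhs L (x * + 2) c (j ℕ.+ j) m ≡ ℓ L
  lhs≡ℓ L₁ = refl
  lhs≡ℓ L₂ = cong (λ h → h + c - + m) (halve (x - + j) (twice-difference x (+ j)))
  lhs≡ℓ L₃ = refl
  lhs≡ℓ L₄ = cong (λ h → h - + m - + 1) (halve (x - + j) (twice-difference x (+ j)))
  lhs≡ℓ L₅ = cong (λ h → h - + m - + 2) (halve (- x - + j) (twice-difference′ x (+ j)))
  lhs≡ℓ L₆ = refl
  lhs≡ℓ L₇ = refl
  lhs≡ℓ L₈ = cong (λ h → h - c - + m - + 3) (halve (- x - + j) (twice-difference′ x (+ j)))

  -- ⟨μ + ρ , β∨⟩ for the simple root β whose reflection exchanges the two neighbours of L.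
  shift : Ineq → ℤ
  shift L = + suc (if short L then m else j ℕ.+ j)

  ℓ-recurrence : ∀ L → ℓ L + ℓ (next (next L)) + shift (next L) ≡ + κ (next L) * ℓ (next L)
  ℓ-recurrence L₂ = recurrence-around-L₁ x c (+ j) (+ m)
  ℓ-recurrence L₁ = recurrence-around-L₄ x c (+ j) (+ m)
  ℓ-recurrence L₄ = recurrence-around-L₆ x c (+ j) (+ m)
  ℓ-recurrence L₆ = recurrence-around-L₈ x c (+ j) (+ m)
  ℓ-recurrence L₈ = recurrence-around-L₇ x c (+ j) (+ m)
  ℓ-recurrence L₇ = recurrence-around-L₅ x c (+ j) (+ m)
  ℓ-recurrence L₅ = recurrence-around-L₃ x c (+ j) (+ m)
  ℓ-recurrence L₃ = recurrence-around-L₂ x c (+ j) (+ m)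

  forward : ∀ L → + κ (next L) * ℓ (next L) - ℓ L - shift (next L) ≡ ℓ (next (next L))
  forward L = isolate₂ (ℓ-recurrence L)

  backward : ∀ L → + κ (next L) * ℓ (next L) - ℓ (next (next L)) - shift (next L) ≡ ℓ L
  backward L = isolate₁ (ℓ-recurrence L)

  reflect₁ : ∀ {v p q p′} → v ≡ ν ⊕ p α₁+ q α₂ → + 2 * q - p - + suc (j ℕ.+ j) ≡ p′ →
             s₁-act v ≡ ν ⊕ p′ α₁+ q α₂
  reflect₁ refl refl = s₁-act-shifted (+ (j ℕ.+ j)) (+ m) _ _

  reflect₂ : ∀ {v p q q′} → v ≡ ν ⊕ p α₁+ q α₂ → + 1 * p - q - + suc m ≡ q′ →
             s₂-act v ≡ ν ⊕ p α₁+ q′ α₂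
  reflect₂ refl refl = s₂-act-shifted (+ (j ℕ.+ j)) (+ m) _ _

  opaque
    unfolding _α₁+_α₂

    λ+ρ-coordinates : lam ⊕ ρ ≡ ν ⊕ ℓ L₁ α₁+ ℓ L₂ α₂
    λ+ρ-coordinates = cong₂ _,_ (ϖ₁-part x c (+ j) (+ m)) (ϖ₂-part x c (+ j) (+ m))
      where
      ϖ₁-part : ∀ x c J M →
        x * + 2 + 1ℤ ≡ J + J + 1ℤ + ((x * + 2 + c - (J + J) - M) * + 2 + (x - J + c - M) * - + 2)
      ϖ₁-part = solve-∀
      ϖ₂-part : ∀ x c J M →
        c + 1ℤ ≡ M + 1ℤ + ((x * + 2 + c - (J + J) - M) * -1ℤ + (x - J + c - M) * + 2)
      ϖ₂-part = solve-∀

  -- Walk around the octagon from σ = e in both directions, one simple reflection at a time.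
  orbit : ∀ σ → act σ (lam ⊕ ρ) ≡ ν ⊕ ℓ (α₁-coefficient σ) α₁+ ℓ (α₂-coefficient σ) α₂
  orbit e       = λ+ρ-coordinates
  orbit s₁      = reflect₁ λ+ρ-coordinates (backward L₃)
  orbit s₂s₁    = reflect₂ (reflect₁ λ+ρ-coordinates (backward L₃)) (backward L₅)
  orbit s₁s₂s₁  = reflect₁ (reflect₂ (reflect₁ λ+ρ-coordinates
                    (backward L₃)) (backward L₅)) (backward L₇)
  orbit [s₂s₁]² = reflect₂ (reflect₁ (reflect₂ (reflect₁ λ+ρ-coordinates
                    (backward L₃)) (backward L₅)) (backward L₇)) (backward L₈)
  orbit s₂      = reflect₂ λ+ρ-coordinates (forward L₂)
  orbit s₁s₂    = reflect₁ (reflect₂ λ+ρ-coordinates (forward L₂)) (forward L₁)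
  orbit s₂s₁s₂  = reflect₂ (reflect₁ (reflect₂ λ+ρ-coordinates
                    (forward L₂)) (forward L₁)) (forward L₄)

  coordinates : ∀ σ → act σ (lam ⊕ ρ) ⊖ ν ≡ ℓ (α₁-coefficient σ) α₁+ ℓ (α₂-coefficient σ) α₂
  coordinates σ = trans (cong (_⊖ ν) (orbit σ)) (⊕-⊖-cancel ν _)

  Holds-λμ : Ineq → Set
  Holds-λμ L = Holds L (x * + 2) c (j ℕ.+ j) m

  Holds-λμ? : ∀ L → Dec (Holds-λμ L)
  Holds-λμ? L = 0ℤ ≤? lhs L (x * + 2) c (j ℕ.+ j) m

  𝒜⇔InCone : ∀ σ → 𝒜 lam μ σ ⇔ InCone Holds-λμ σ
  𝒜⇔InCone σ = subst (λ ξ → (0 ℕ.< ℘ ξ) ⇔ InCone Holds-λμ σ) (sym (coordinates σ))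
    (subst₂ (λ p q → (0 ℕ.< ℘ (ℓ a α₁+ ℓ b α₂)) ⇔ (0ℤ ≤ p × 0ℤ ≤ q)) (sym (lhs≡ℓ a)) (sym (lhs≡ℓ b))
      (℘-positive⇔ (ℓ a) (ℓ b)))
    where
    a b : Ineq
    a = α₁-coefficient σ
    b = α₂-coefficient σ

  lhs-strictly-concave : StrictlyConcave (λ L → lhs L (x * + 2) c (j ℕ.+ j) m)
  lhs-strictly-concave L rewrite lhs≡ℓ L | lhs≡ℓ (next L) | lhs≡ℓ (next (next L)) =
    positive-gap⇒< (+<+ (s≤s z≤n)) (ℓ-recurrence L)

even : ∀ {n} → + 2 ∣ + n → ∃[ j ] n ≡ j ℕ.+ j
even (ℕ.divides j refl) = j , trans (ℕ.*-suc j 1) (cong (j ℕ.+_) (ℕ.*-identityʳ j))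

≐-resp-⇔ : ∀ {A B : W → Set} {S} → (∀ σ → A σ ⇔ B σ) → B ≐ S → A ≐ S
≐-resp-⇔ A⇔B B≐S σ = ⇔.trans (A⇔B σ) (B≐S σ)

theorem3p4 : (c₁ c₂ : ℤ) (n m : ℕ) → + 2 ∣ c₁ → + 2 ∣ + n →
    ((C : Case) → C ∈ cases → CaseHolds C c₁ c₂ n m → 𝒜 (c₁ , c₂) (+ n , + m) ≐ Case.set C)
    × (((C : Case) → C ∈ cases → ¬ CaseHolds C c₁ c₂ n m) → 𝒜 (c₁ , c₂) (+ n , + m) ≐ [])
theorem3p4 c₁ c₂ n m 2∣c₁ 2∣n with ∣ᵤ⇒∣ {+ 2} {c₁} 2∣c₁ | even 2∣n
... | divides x refl | j , refl =
  (λ C C∈cases holds → ≐-resp-⇔ 𝒜⇔InCone (proj₁ table C C∈cases holds)) ,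
  (λ none → ≐-resp-⇔ 𝒜⇔InCone (proj₂ table none))
  where
  open Orbit x c₂ j m
  table : Table Holds-λμ
  table = alternation-table Holds-λμ? (strictly-concave⇒convex lhs-strictly-concave)
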